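{- Let $s$ and $t$ be positive integers and let $G=(V,E)$ be a connected graph containing no induced $P_t$, no induced $SDK_s$ and no $K_4$. Let $S_{t-1}$ be produced by the construction described in the context (for any choices made in it). Then: (1) there exists a constant $M_{s,t}$ depending only on $s$ and $t$ such that $|S_{t-1}|\le M_{s,t}$; (2) $V\setminus(S_{t-1}\cup N(S_{t-1}))=\emptyset$.
   Context: $P_t$ is the path on $t$ vertices; $SDK_s$ is the one-subdivision of $K_{1,s}$, obtained from the star $K_{1,s}$ by replacing each edge $uv$ by a path $u w v$ through a new vertex $w$. For $v\in V$, $N(v)$ is the set of neighbors of $v$, and for $X\subseteq V$, $N(X)=\bigcup_{v\in X}N(v)$. Construction: pick an arbitrary vertex $a\in V$ and set $S_1=\{a\}$. For $i=1,2,\dots,t-2$: let $B_i=N(S_i)$ and $W_i=V\setminus(B_i\cup S_i)$; write $S_i=\{v_1,\dots,v_{|S_i|}\}$ (any order) and for $j=1,\dots,|S_i|$ let $B_i^j=\{v\in B_i\setminus\bigcup_{k=1}^{j-1}B_i^k : v \text{ is adjacent to } v_j\}$; for each $j$ let $X_i^j\subseteq B_i^j$ be an inclusion-minimal set such that every $w\in W_i$ with $N(w)\cap B_i^j\neq\emptyset$ satisfies $N(w)\cap X_i^j\neq\emptyset$; let $X_i=\bigcup_j X_i^j$ and $S_{i+1}=S_i\cup X_i$. -}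

module Defs where

open import Data.Nat using (ℕ; zero; suc; _+_; _≤_; _<_; _≡ᵇ_; _≤ᵇ_)
open import Data.Bool using (Bool; true; false; _∧_; _∨_; if_then_else_)
open import Data.Fin using (Fin; toℕ)
open import Data.Fin.Subset using (Subset; _∈_; _⊆_; _∪_; _∩_; ∁; _─_; ⋃)
open import Data.Vec using (tabulate; lookup)
open import Data.List using (List; []; _∷_)
open import Data.Bool.ListAction using (any)
open import Data.List.Relation.Unary.Unique.Propositional using (Unique)
open import Data.List.Relation.Binary.Pointwise using (Pointwise)
import Data.List.Membership.Propositional as LM
open import Data.List using (allFin)
open import Data.Product using (Σ; ∃; ∃-syntax; _×_; _,_)
open import Function.Bundles using (_⇔_)
open import Function.Definitions using (Injective)
open import Relation.Binary.PropositionalEquality using (_≡_; _≢_)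

record Graph (n : ℕ) : Set where
  field
    adj   : Fin n → Fin n → Bool
    sym   : ∀ u v → adj u v ≡ adj v u
    irrfl : ∀ v → adj v v ≡ false
open Graph public

Adj : ∀ {n} → Graph n → Fin n → Fin n → Set
Adj G u v = adj G u v ≡ true

data Walk {n} (G : Graph n) : Fin n → Fin n → Set where
  here : ∀ {v} → Walk G v v
  step : ∀ {u v w} → Adj G u v → Walk G v w → Walk G u w

Connected : ∀ {n} → Graph n → Set
Connected G = ∀ u v → Walk G u v

InducedIn : ∀ {k n} → (Fin k → Fin k → Bool) → Graph n → Set
InducedIn {k} {n} H G =
  Σ (Fin k → Fin n) λ f → Injective _≡_ _≡_ f × (∀ i j → adj G (f i) (f j) ≡ H i j)

-- K₄ as a subgraph (equivalently induced, since it is complete)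
HasK4 : ∀ {n} → Graph n → Set
HasK4 {n} G = Σ (Fin 4 → Fin n) λ f → Injective _≡_ _≡_ f × (∀ i j → i ≢ j → Adj G (f i) (f j))

pathAdjℕ : ℕ → ℕ → Bool
pathAdjℕ i j = (suc i ≡ᵇ j) ∨ (suc j ≡ᵇ i)

-- SDK_s on vertices 0,…,2s: centre 0, subdivision vertices 1..s, leaves s+1..2s;
-- centre ~ m for 1 ≤ m ≤ s, and m ~ m + s for 1 ≤ m ≤ s.
sdkAdjHalf : ℕ → ℕ → ℕ → Bool
sdkAdjHalf s u v =
  ((u ≡ᵇ 0) ∧ (1 ≤ᵇ v) ∧ (v ≤ᵇ s)) ∨ ((1 ≤ᵇ u) ∧ (u ≤ᵇ s) ∧ (v ≡ᵇ u + s))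

sdkAdjℕ : ℕ → ℕ → ℕ → Bool
sdkAdjℕ s u v = sdkAdjHalf s u v ∨ sdkAdjHalf s v u

P : (t : ℕ) → Fin t → Fin t → Bool
P t i j = pathAdjℕ (toℕ i) (toℕ j)

SDK : (s : ℕ) → Fin (suc (s + s)) → Fin (suc (s + s)) → Bool
SDK s i j = sdkAdjℕ s (toℕ i) (toℕ j)

N : ∀ {n} → Graph n → Subset n → Subset n
N {n} G X = tabulate λ v → any (λ u → lookup X u ∧ adj G u v) (allFin n)

Nv : ∀ {n} → Graph n → Fin n → Subset n
Nv G v = tabulate λ u → adj G v u

-- Given B = B_i and an ordering v_1,…,v_m of S_i, the list B_i^1,…,B_i^m,
-- where B_i^j = (B_i ∖ (B_i^1 ∪ … ∪ B_i^{j-1})) ∩ N(v_j).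
-- `used` accumulates B_i^1 ∪ … ∪ B_i^{j-1}.
Bparts : ∀ {n} → Graph n → Subset n → Subset n → List (Fin n) → List (Subset n)
Bparts G B used []       = []
Bparts G B used (v ∷ vs) = Bj ∷ Bparts G B (used ∪ Bj) vs
  where Bj = (B ─ used) ∩ Nv G v

Dominates : ∀ {n} → Graph n → Subset n → Subset n → Subset n → Set
Dominates G W Bj X =
  ∀ w → w ∈ W → (∃[ b ] (b ∈ Bj × Adj G w b)) → ∃[ x ] (x ∈ X × Adj G w x)

MinDom : ∀ {n} → Graph n → Subset n → Subset n → Subset n → Set
MinDom G W Bj X =
  X ⊆ Bj × Dominates G W Bj X × (∀ Y → Y ⊆ X → Dominates G W Bj Y → X ⊆ Y)

-- One step of the construction: S' = S_{i+1} is obtainable from S = S_i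
-- for some ordering of S and some choice of the minimal sets X_i^j.
Step : ∀ {n} → Graph n → Subset n → Subset n → Set
Step {n} G S S' =
  Σ (List (Fin n)) λ vs →
    Unique vs × (∀ v → (v ∈ S) ⇔ (v LM.∈ vs)) ×
    Σ (List (Subset n)) λ Xs →
      Pointwise (MinDom G W) (Bparts G B Data.Fin.Subset.⊥ vs) Xs ×
      S' ≡ S ∪ ⋃ Xs
  where
    B = N G S
    W = ∁ (B ∪ S)

module Submission where

-- Part (2): one step turns "distance ≤ 2 from S" into "distance ≤ 1 from S′",
-- since the minimal sets X^j dominate the vertices of W next to B^j; so N[S_{k+1}]
-- contains the ball of radius k around a, which is everything, as a vertex at
-- distance k + 1 would give an induced P_{k+2} along a geodesic.
-- Part (1): each step adds one set X^j ⊆ N(v_j) per v_j ∈ S.  By minimality each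
-- member of X^j has a private neighbour in W, outside N[v_j]; Ramsey inside X^j
-- and then among the private neighbours of an independent subset turns |X^j| ≥ R
-- into a K₄ or an induced SDK_s centred at v_j.  Hence |S′| ≤ |S|(R + 1).

open import Defs
open import Data.Nat using (ℕ; zero; suc; _+_; _*_; _^_; _∸_; _≤_; _<_; z≤n; s≤s; _≡ᵇ_; _≤ᵇ_)
open import Data.Nat.Properties
  using ( _≟_; _≤?_; ≤-refl; ≤-reflexive; ≤-trans; ≤-antisym; ≤-pred; n≤1+n; m≤m+n; m≤n+m
        ; <-cmp; <-irrefl; <⇒≤; <⇒≱; ≤∧≢⇒<; ≰⇒>; ≰⇒≥; +-suc; +-comm; +-mono-≤; +-monoˡ-≤; +-monoʳ-≤
        ; +-cancelˡ-≤; +-cancelʳ-≡; *-monoˡ-≤; *-suc; *-comm; suc-injective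
        ; ≡ᵇ⇒≡; ≡⇒≡ᵇ; ≤ᵇ⇒≤; ≤⇒≤ᵇ; module ≤-Reasoning )
open import Data.Bool using (Bool; true; false; _∧_) renaming (_≟_ to _≟ᵇ_)
open import Data.Bool.Properties using (T-≡; T-∧; T-∨; ¬-not; ∧-conicalˡ; ∧-conicalʳ)
open import Data.Fin using (Fin; zero; suc; toℕ; splitAt)
import Data.Fin as Fin
open import Data.Fin.Properties
  using (toℕ-injective; toℕ<n; join-splitAt; toℕ-↑ˡ; toℕ-↑ʳ; any?) renaming (_≟_ to _≟ᶠ_; suc-injective to Fin-suc-injective)
open import Data.Fin.Subset using (Subset; _∈_; _∉_; _⊆_; _∪_; _∩_; _─_; _-_; ∁; ⋃; ⁅_⁆; ∣_∣; Empty)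
import Data.Fin.Subset as Subset
open import Data.Fin.Subset.Properties
  using ( _∈?_; x∈p∪q⁻; p⊆p∪q; q⊆p∪q; x∈p∩q⁺; x∈p∩q⁻; x∈p∧x∉q⇒x∈p─q; x∈p∧x≢y⇒x∈p-y; p─q⊆p
        ; x∈⁅x⁆; x∈⁅y⁆⇒x≡y; x∉p⇒x∈∁p; x∈p⇒x∉∁p; ∉⊥; ∣⊥∣≡0; ∣⁅x⁆∣≡1; x∈p⇒∣p-x∣<∣p∣; p⊆q⇒∣p∣≤∣q∣ )
open import Data.Vec using ([]; _∷_; tabulate)
open import Data.Vec.Base using () renaming (here to ∈-zero; there to ∈-suc)
open import Data.Vec.Properties using (lookup∘tabulate; []=⇒lookup; lookup⇒[]=)
open import Data.List using (List; []; _∷_; length; map; filter; allFin)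
open import Data.List.Properties using (length-map; length-tabulate)
open import Data.List.Membership.Propositional using (find; lose) renaming (_∈_ to _∈ₗ_)
open import Data.List.Membership.Propositional.Properties using (∈-allFin; ∈-filter⁻; ∈-map⁻)
open import Data.List.Relation.Unary.Any using (here; there)
import Data.List.Relation.Unary.Any.Properties as Any
open import Data.List.Relation.Unary.All using (All; []; _∷_)
import Data.List.Relation.Unary.All as All
import Data.List.Relation.Unary.All.Properties as All
open import Data.List.Relation.Unary.AllPairs using ([]; _∷_)
open import Data.List.Relation.Unary.Unique.Propositional using (Unique)
import Data.List.Relation.Unary.Unique.Propositional.Properties as Unique
open import Data.List.Relation.Binary.Pointwise using (Pointwise; []; _∷_; Pointwise-length)
open import Data.Product using (Σ; ∃-syntax; _×_; _,_; proj₁; proj₂)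
open import Data.Sum using (_⊎_; inj₁; inj₂; [_,_]′)
import Data.Sum as Sum
open import Data.Empty using (⊥; ⊥-elim)
open import Function using (_∘_)
open import Function.Bundles using (Equivalence)
open import Function.Definitions using (Injective)
open import Relation.Binary.Definitions using (tri<; tri≈; tri>)
open import Relation.Nullary using (¬_; Dec; yes; no; ¬?; _×-dec_)
open import Relation.Binary.PropositionalEquality using (_≡_; _≢_; refl; cong; trans; subst) renaming (sym to ≡-sym)

Bool-ext : ∀ {b c : Bool} → (b ≡ true → c ≡ true) → (c ≡ true → b ≡ true) → b ≡ c
Bool-ext {true}  b⇒c _   = ≡-sym (b⇒c refl)
Bool-ext {false} {true}  _ c⇒b = c⇒b refl
Bool-ext {false} {false} _ _   = refl

true≢false : ∀ {b c : Bool} → b ≡ true → c ≡ false → b ≢ c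
true≢false refl refl ()

∈-tabulate⁻ : ∀ {n} {f : Fin n → Bool} {x} → x ∈ tabulate f → f x ≡ true
∈-tabulate⁻ {f = f} {x} x∈ = trans (≡-sym (lookup∘tabulate f x)) ([]=⇒lookup x∈)

∈-tabulate⁺ : ∀ {n} {f : Fin n → Bool} {x} → f x ≡ true → x ∈ tabulate f
∈-tabulate⁺ {f = f} {x} fx = lookup⇒[]= x (tabulate f) (trans (lookup∘tabulate f x) fx)

module GraphBasics {n} (G : Graph n) where

  Adj-sym : ∀ {u v} → Adj G u v → Adj G v u
  Adj-sym {u} {v} uv = trans (Graph.sym G v u) uv

  Adj-irrefl : ∀ {u v} → Adj G u v → u ≢ v
  Adj-irrefl {u} uu refl with trans (≡-sym uu) (irrfl G u)
  ... | ()

  Nonadj : ∀ {u v} → ¬ Adj G u v → adj G u v ≡ false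
  Nonadj = ¬-not

  Adj? : ∀ u v → Dec (Adj G u v)
  Adj? u v with adj G u v
  ... | true  = yes refl
  ... | false = no λ ()

  N-intro : ∀ {X u v} → u ∈ X → Adj G u v → v ∈ N G X
  N-intro {X} {u} u∈X uv = ∈-tabulate⁺ (Equivalence.to T-≡
    (Any.any⁺ _ (lose (∈-allFin u) (Equivalence.from T-≡ (∧-intro ([]=⇒lookup u∈X) uv)))))
    where ∧-intro : ∀ {a b} → a ≡ true → b ≡ true → a ∧ b ≡ true
          ∧-intro refl b = b

  N-elim : ∀ {X v} → v ∈ N G X → ∃[ u ] (u ∈ X × Adj G u v)
  N-elim {X} {v} v∈N with find (Any.any⁻ _ (allFin n) (Equivalence.from T-≡ (∈-tabulate⁻ v∈N)))
  ... | u , _ , Tu = u , lookup⇒[]= u X (∧-conicalˡ _ _ Xu∧uv) , ∧-conicalʳ _ _ Xu∧uv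
    where Xu∧uv = Equivalence.to T-≡ Tu

  N-mono : ∀ {X Y} → X ⊆ Y → N G X ⊆ N G Y
  N-mono X⊆Y v∈NX with N-elim v∈NX
  ... | u , u∈X , uv = N-intro (X⊆Y u∈X) uv

  Nv-intro : ∀ {v u} → Adj G v u → u ∈ Nv G v
  Nv-intro = ∈-tabulate⁺

  Nv-elim : ∀ {v u} → u ∈ Nv G v → Adj G v u
  Nv-elim = ∈-tabulate⁻

  N[_] : Subset n → Subset n
  N[ X ] = X ∪ N G X

  N[]-mono : ∀ {X Y} → X ⊆ Y → N[ X ] ⊆ N[ Y ]
  N[]-mono {X} {Y} X⊆Y v∈ with x∈p∪q⁻ X (N G X) v∈
  ... | inj₁ v∈X  = p⊆p∪q (N G Y) (X⊆Y v∈X)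
  ... | inj₂ v∈NX = q⊆p∪q Y (N G Y) (N-mono X⊆Y v∈NX)

  N[]-adj : ∀ {X u v} → u ∈ X → Adj G u v → v ∈ N[ X ]
  N[]-adj {X} u∈X uv = q⊆p∪q X (N G X) (N-intro u∈X uv)

-- Upper bounds for the two-colour Ramsey numbers, from the Erdős–Szekeres recursion.
ramseyBound : ℕ → ℕ → ℕ
ramseyBound zero    l       = zero
ramseyBound (suc k) zero    = zero
ramseyBound (suc k) (suc l) = suc (ramseyBound k (suc l) + ramseyBound (suc k) l)

split-≤ : ∀ a b x y → a + b ≤ x + y → a ≤ x ⊎ b ≤ y
split-≤ a b x y a+b≤x+y with a ≤? x
... | yes a≤x = inj₁ a≤x
... | no  a≰x = inj₂ (+-cancelˡ-≤ x b y (≤-trans (+-monoˡ-≤ b (≰⇒≥ a≰x)) a+b≤x+y))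

module Ramsey {A : Set} (E : A → A → Bool) (E-sym : ∀ x y → E x y ≡ E y x) where

  Homogeneous : Bool → ℕ → List A → Set
  Homogeneous b k xs = Σ (Fin k → A) λ h →
    Injective _≡_ _≡_ h × (∀ i → h i ∈ₗ xs) × (∀ i j → i ≢ j → E (h i) (h j) ≡ b)

  empty : ∀ b xs → Homogeneous b 0 xs
  empty b xs = (λ ()) , (λ { {()} }) , (λ ()) , λ ()

  weaken : ∀ {b k xs ys} → (∀ {y} → y ∈ₗ ys → y ∈ₗ xs) → Homogeneous b k ys → Homogeneous b k xs
  weaken ys⊆xs (h , h-inj , h∈ , h-col) = h , h-inj , (λ i → ys⊆xs (h∈ i)) , h-col

  nbr : Bool → A → List A → List A
  nbr b v = filter (λ y → E v y ≟ᵇ b)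

  nbr⊆ : ∀ {b v ys y} → y ∈ₗ nbr b v ys → y ∈ₗ (v ∷ ys)
  nbr⊆ {b} {v} {ys} m = there (proj₁ (∈-filter⁻ (λ y → E v y ≟ᵇ b) {xs = ys} m))

  length-nbr : ∀ v ys → length (nbr true v ys) + length (nbr false v ys) ≡ length ys
  length-nbr v []       = refl
  length-nbr v (y ∷ ys) with E v y
  ... | true  = cong suc (length-nbr v ys)
  ... | false = trans (+-suc _ _) (cong suc (length-nbr v ys))

  grow : ∀ {b k v ys} → All (v ≢_) ys → Homogeneous b k (nbr b v ys) → Homogeneous b (suc k) (v ∷ ys)
  grow {b} {k} {v} {ys} v∉ys (h , h-inj , h∈ , h-col) = h′ , h′-inj , h′∈ , h′-col
    where
      v-col : ∀ i → E v (h i) ≡ b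
      v-col i = proj₂ (∈-filter⁻ (λ y → E v y ≟ᵇ b) {xs = ys} (h∈ i))
      v≢h : ∀ i → v ≢ h i
      v≢h i = All.lookup (All.filter⁺ (λ y → E v y ≟ᵇ b) v∉ys) (h∈ i)
      h′ : Fin (suc k) → A
      h′ zero    = v
      h′ (suc i) = h i
      h′-inj : Injective _≡_ _≡_ h′
      h′-inj {zero}  {zero}  _ = refl
      h′-inj {zero}  {suc j} e = ⊥-elim (v≢h j e)
      h′-inj {suc i} {zero}  e = ⊥-elim (v≢h i (≡-sym e))
      h′-inj {suc i} {suc j} e = cong suc (h-inj e)
      h′∈ : ∀ i → h′ i ∈ₗ (v ∷ ys)
      h′∈ zero    = here refl
      h′∈ (suc i) = nbr⊆ (h∈ i)
      h′-col : ∀ i j → i ≢ j → E (h′ i) (h′ j) ≡ b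
      h′-col zero    zero    i≢j = ⊥-elim (i≢j refl)
      h′-col zero    (suc j) _   = v-col j
      h′-col (suc i) zero    _   = trans (E-sym (h i) v) (v-col i)
      h′-col (suc i) (suc j) i≢j = h-col i j (λ e → i≢j (cong suc e))

  ramsey : ∀ k l xs → Unique xs → ramseyBound k l ≤ length xs →
           Homogeneous true k xs ⊎ Homogeneous false l xs
  ramsey zero    l       xs _ _ = inj₁ (empty true xs)
  ramsey (suc k) zero    xs _ _ = inj₂ (empty false xs)
  ramsey (suc k) (suc l) (v ∷ ys) (v∉ys ∷ ys-unique) (s≤s bound)
    with split-≤ (ramseyBound k (suc l)) (ramseyBound (suc k) l) _ _
                 (subst (_ ≤_) (≡-sym (length-nbr v ys)) bound)
  ... | inj₁ enough with ramsey k (suc l) (nbr true v ys) (Unique.filter⁺ _ ys-unique) enough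
  ...   | inj₁ hom = inj₁ (grow v∉ys hom)
  ...   | inj₂ hom = inj₂ (weaken nbr⊆ hom)
  ramsey (suc k) (suc l) (v ∷ ys) (v∉ys ∷ ys-unique) (s≤s bound)
      | inj₂ enough with ramsey (suc k) l (nbr false v ys) (Unique.filter⁺ _ ys-unique) enough
  ...   | inj₁ hom = inj₁ (weaken nbr⊆ hom)
  ...   | inj₂ hom = inj₂ (grow v∉ys hom)

elements : ∀ {n} → Subset n → List (Fin n)
elements []            = []
elements (true  ∷ p) = zero ∷ map suc (elements p)
elements (false ∷ p) = map suc (elements p)

length-elements : ∀ {n} (p : Subset n) → length (elements p) ≡ ∣ p ∣
length-elements []            = refl
length-elements (true  ∷ p) = cong suc (trans (length-map suc (elements p)) (length-elements p))
length-elements (false ∷ p) = trans (length-map suc (elements p)) (length-elements p)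

∈-elements : ∀ {n} (p : Subset n) {x} → x ∈ₗ elements p → x ∈ p
∈-elements (true  ∷ p) (here refl) = ∈-zero
∈-elements (true  ∷ p) (there x∈) with ∈-map⁻ suc x∈
... | y , y∈ , refl = ∈-suc (∈-elements p y∈)
∈-elements (false ∷ p) x∈ with ∈-map⁻ suc x∈
... | y , y∈ , refl = ∈-suc (∈-elements p y∈)

elements-unique : ∀ {n} (p : Subset n) → Unique (elements p)
elements-unique []            = []
elements-unique (true  ∷ p) = zero∉ (elements p) ∷ Unique.map⁺ Fin-suc-injective (elements-unique p)
  where zero∉ : ∀ {n} (ys : List (Fin n)) → All (Fin.zero {n} ≢_) (map Fin.suc ys)
        zero∉ []       = []
        zero∉ (y ∷ ys) = (λ ()) ∷ zero∉ ys
elements-unique (false ∷ p) = Unique.map⁺ Fin-suc-injective (elements-unique p)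

length-unique≤ : ∀ {n} (S : Subset n) xs → Unique xs → (∀ {x} → x ∈ₗ xs → x ∈ S) → length xs ≤ ∣ S ∣
length-unique≤ S []       _            _    = z≤n
length-unique≤ S (x ∷ xs) (x∉xs ∷ xs!) xs⊆S =
  ≤-trans (s≤s (length-unique≤ (S - x) xs xs! xs⊆S-x)) (x∈p⇒∣p-x∣<∣p∣ (xs⊆S (here refl)))
  where xs⊆S-x : ∀ {y} → y ∈ₗ xs → y ∈ S - x
        xs⊆S-x y∈ = x∈p∧x≢y⇒x∈p-y (xs⊆S (there y∈)) (λ y≡x → All.lookup x∉xs y∈ (≡-sym y≡x))

∣p∪q∣≤∣p∣+∣q∣ : ∀ {n} (p q : Subset n) → ∣ p ∪ q ∣ ≤ ∣ p ∣ + ∣ q ∣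
∣p∪q∣≤∣p∣+∣q∣ []          []          = z≤n
∣p∪q∣≤∣p∣+∣q∣ (true  ∷ p) (true  ∷ q) = s≤s (≤-trans (∣p∪q∣≤∣p∣+∣q∣ p q)
                                           (≤-trans (n≤1+n _) (≤-reflexive (≡-sym (+-suc ∣ p ∣ ∣ q ∣)))))
∣p∪q∣≤∣p∣+∣q∣ (true  ∷ p) (false ∷ q) = s≤s (∣p∪q∣≤∣p∣+∣q∣ p q)
∣p∪q∣≤∣p∣+∣q∣ (false ∷ p) (true  ∷ q) = ≤-trans (s≤s (∣p∪q∣≤∣p∣+∣q∣ p q)) (≤-reflexive (≡-sym (+-suc ∣ p ∣ ∣ q ∣)))
∣p∪q∣≤∣p∣+∣q∣ (false ∷ p) (false ∷ q) = ∣p∪q∣≤∣p∣+∣q∣ p q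

∣⋃∣≤ : ∀ {n} K (Xs : List (Subset n)) → All (λ X → ∣ X ∣ ≤ K) Xs → ∣ ⋃ Xs ∣ ≤ length Xs * K
∣⋃∣≤ {n} K []       []          = ≤-reflexive (∣⊥∣≡0 n)
∣⋃∣≤     K (X ∷ Xs) (X≤ ∷ Xs≤) = ≤-trans (∣p∪q∣≤∣p∣+∣q∣ X (⋃ Xs)) (+-mono-≤ X≤ (∣⋃∣≤ K Xs Xs≤))

pathAdj⇒ : ∀ i j → pathAdjℕ i j ≡ true → suc i ≡ j ⊎ suc j ≡ i
pathAdj⇒ i j ij = Sum.map (≡ᵇ⇒≡ _ _) (≡ᵇ⇒≡ _ _) (Equivalence.to T-∨ (Equivalence.from T-≡ ij))

pathAdj⇐ : ∀ i j → suc i ≡ j ⊎ suc j ≡ i → pathAdjℕ i j ≡ true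
pathAdj⇐ i j h = Equivalence.to T-≡ (Equivalence.from T-∨ (Sum.map (≡⇒≡ᵇ _ _) (≡⇒≡ᵇ _ _) h))

module Distance {n} (G : Graph n) (a : Fin n) where
  open GraphBasics G

  Ball : ℕ → Subset n
  Ball zero    = ⁅ a ⁆
  Ball (suc k) = N[ Ball k ]

  Sphere : ℕ → Fin n → Set
  Sphere zero    x = x ≡ a
  Sphere (suc k) x = x ∈ Ball (suc k) × x ∉ Ball k

  Ball-mono : ∀ {i j} → i ≤ j → Ball i ⊆ Ball j
  Ball-mono {zero}  {zero}  _ x∈ = x∈
  Ball-mono {zero}  {suc j} _ x∈ = p⊆p∪q _ (Ball-mono {zero} {j} z≤n x∈)
  Ball-mono {suc i} {suc j} (s≤s i≤j) = N[]-mono (Ball-mono i≤j)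

  Sphere⇒Ball : ∀ k {x} → Sphere k x → x ∈ Ball k
  Sphere⇒Ball zero    refl    = x∈⁅x⁆ a
  Sphere⇒Ball (suc k) (x∈ , _) = x∈

  Sphere-adj : ∀ i j {x y} → Sphere i x → Sphere j y → Adj G x y → j ≤ suc i
  Sphere-adj i zero    _  _        _  = z≤n
  Sphere-adj i (suc j) sx (_ , y∉) xy with suc j ≤? suc i
  ... | yes j≤i = j≤i
  ... | no  j≰i = ⊥-elim (y∉ (Ball-mono (≤-pred (≰⇒> j≰i)) (N[]-adj (Sphere⇒Ball i sx) xy)))

  Sphere-disjoint : ∀ i j {x} → Sphere i x → Sphere j x → ¬ i < j
  Sphere-disjoint i (suc j) si (_ , x∉) (s≤s i≤j) = x∉ (Ball-mono i≤j (Sphere⇒Ball i si))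

  Sphere-unique : ∀ i j {x} → Sphere i x → Sphere j x → i ≡ j
  Sphere-unique i j si sj with <-cmp i j
  ... | tri< i<j _ _ = ⊥-elim (Sphere-disjoint i j si sj i<j)
  ... | tri≈ _ i≡j _ = i≡j
  ... | tri> _ _ j<i = ⊥-elim (Sphere-disjoint j i sj si j<i)

  leave : ∀ k {u} → Walk G u a → u ∉ Ball k → ∃[ x ] Sphere (suc k) x
  leave k here u∉ = ⊥-elim (u∉ (Ball-mono {0} {k} z≤n (x∈⁅x⁆ a)))
  leave k {u} (step {v = v} uv walk) u∉ with v ∈? Ball k
  ... | yes v∈ = u , N[]-adj v∈ (Adj-sym uv) , u∉
  ... | no  v∉ = leave k walk v∉

  parent : ∀ k {p} → Sphere (suc k) p → ∃[ q ] (Sphere k q × Adj G q p)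
  parent k {p} (p∈ , p∉) with x∈p∪q⁻ (Ball k) (N G (Ball k)) p∈
  ... | inj₁ p∈B = ⊥-elim (p∉ p∈B)
  ... | inj₂ p∈N with N-elim p∈N
  ... | q , q∈ , qp = q , sphere k q∈ p∉ , qp
    where sphere : ∀ k → q ∈ Ball k → p ∉ Ball k → Sphere k q
          sphere zero    q∈ _  = x∈⁅y⁆⇒x≡y a q∈
          sphere (suc k) q∈ p∉ = q∈ , λ q∈′ → p∉ (N[]-adj q∈′ qp)

  record Geodesic (m : ℕ) (p : Fin n) : Set where
    field
      vertex  : ℕ → Fin n
      ends    : vertex m ≡ p
      layered : ∀ i → i ≤ m → Sphere i (vertex i)
      linked  : ∀ i → i < m → Adj G (vertex i) (vertex (suc i))

  geodesic : ∀ m {p} → Sphere m p → Geodesic m p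
  geodesic zero {p} sp = record
    { vertex = λ _ → p ; ends = refl ; layered = λ { zero _ → sp } ; linked = λ _ () }
  geodesic (suc m) {p} sp with parent m sp
  ... | q , sq , qp = extend (geodesic m sq)
    where
      extend : Geodesic m q → Geodesic (suc m) p
      extend γ = record { vertex = vertex′ ; ends = ends′ ; layered = layered′ ; linked = linked′ }
        where
          open Geodesic γ
          vertex′ : ℕ → Fin n
          vertex′ i with i ≟ suc m
          ... | yes _ = p
          ... | no  _ = vertex i
          ends′ : vertex′ (suc m) ≡ p
          ends′ with suc m ≟ suc m
          ... | yes _ = refl
          ... | no  m≢m = ⊥-elim (m≢m refl)
          layered′ : ∀ i → i ≤ suc m → Sphere i (vertex′ i)
          layered′ i i≤ with i ≟ suc m
          ... | yes refl = sp
          ... | no  i≢  = layered i (≤-pred (≤∧≢⇒< i≤ i≢))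
          linked′ : ∀ i → i < suc m → Adj G (vertex′ i) (vertex′ (suc i))
          linked′ i (s≤s i≤m) with i ≟ suc m | suc i ≟ suc m
          ... | yes refl | _        = ⊥-elim (<-irrefl refl (s≤s i≤m))
          ... | no  _    | yes refl = subst (λ z → Adj G z p) (≡-sym ends) qp
          ... | no  _    | no  i≢  = linked i (≤-pred (≤∧≢⇒< (s≤s i≤m) i≢))

  geodesic-induced : ∀ {m p} → Geodesic m p → InducedIn (P (suc m)) G
  geodesic-induced {m} γ = f , f-injective , f-adj
    where
      open Geodesic γ
      f : Fin (suc m) → Fin n
      f i = vertex (toℕ i)
      bound : ∀ (i : Fin (suc m)) → toℕ i ≤ m
      bound i = ≤-pred (toℕ<n i)
      f-injective : ∀ {i j} → f i ≡ f j → i ≡ j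
      f-injective {i} {j} fi≡fj = toℕ-injective (Sphere-unique _ _ (layered _ (bound i))
        (subst (Sphere (toℕ j)) (≡-sym fi≡fj) (layered _ (bound j))))
      f-adj : ∀ i j → adj G (f i) (f j) ≡ P (suc m) i j
      f-adj i j = Bool-ext (pathAdj⇐ (toℕ i) (toℕ j) ∘ consecutive) adjacent
        where
          si = layered _ (bound i)
          sj = layered _ (bound j)
          consecutive : Adj G (f i) (f j) → suc (toℕ i) ≡ toℕ j ⊎ suc (toℕ j) ≡ toℕ i
          consecutive ij with <-cmp (toℕ i) (toℕ j)
          ... | tri< i<j _ _ = inj₁ (≤-antisym i<j (Sphere-adj _ _ si sj ij))
          ... | tri≈ _ i≡j _ = ⊥-elim (Adj-irrefl ij (cong vertex i≡j))
          ... | tri> _ _ j<i = inj₂ (≤-antisym j<i (Sphere-adj _ _ sj si (Adj-sym ij)))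
          adjacent : P (suc m) i j ≡ true → Adj G (f i) (f j)
          adjacent ij with pathAdj⇒ (toℕ i) (toℕ j) ij
          ... | inj₁ e = subst (λ z → Adj G (f i) (vertex z)) e
                           (linked (toℕ i) (subst (_≤ m) (≡-sym e) (bound j)))
          ... | inj₂ e = Adj-sym (subst (λ z → Adj G (f j) (vertex z)) e
                           (linked (toℕ j) (subst (_≤ m) (≡-sym e) (bound i))))

  Ball-everything : ∀ k → Connected G → ¬ InducedIn (P (suc (suc k))) G → ∀ u → u ∈ Ball k
  Ball-everything k connected no-path u with u ∈? Ball k
  ... | yes u∈ = u∈
  ... | no  u∉ with leave k (connected u a) u∉
  ... | x , sx = ⊥-elim (no-path (geodesic-induced (geodesic (suc k) sx)))

∈-⋃ : ∀ {n} {x : Fin n} {X} Xs → x ∈ X → X ∈ₗ Xs → x ∈ ⋃ Xs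
∈-⋃ (Y ∷ Ys) x∈X (here refl) = p⊆p∪q (⋃ Ys) x∈X
∈-⋃ (Y ∷ Ys) x∈X (there X∈) = q⊆p∪q Y (⋃ Ys) (∈-⋃ Ys x∈X X∈)

Pointwise-partner : ∀ {A B : Set} {R : A → B → Set} {as bs a} →
                    Pointwise R as bs → a ∈ₗ as → ∃[ b ] (b ∈ₗ bs × R a b)
Pointwise-partner (r ∷ _)  (here refl) = _ , here refl , r
Pointwise-partner (_ ∷ rs) (there a∈) with Pointwise-partner rs a∈
... | b , b∈ , r = b , there b∈ , r

Steps : ∀ {n} → Graph n → (ℕ → Subset n) → ℕ → Set
Steps G S k = ∀ i → 1 ≤ i → i ≤ k → Step G (S i) (S (suc i))

Steps-init : ∀ {n} {G : Graph n} {S} k → Steps G S (suc k) → Steps G S k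
Steps-init k steps i 1≤i i≤k = steps i 1≤i (≤-trans i≤k (n≤1+n k))

Steps-last : ∀ {n} {G : Graph n} {S} k → Steps G S (suc k) → Step G (S (suc k)) (S (suc (suc k)))
Steps-last k steps = steps (suc k) (s≤s z≤n) ≤-refl

module _ {n} (G : Graph n) where
  open GraphBasics G

  Bparts-cover : ∀ B used vs {p v} → p ∈ B → v ∈ₗ vs → Adj G v p →
                 p ∈ used ⊎ ∃[ Bj ] (Bj ∈ₗ Bparts G B used vs × p ∈ Bj)
  Bparts-cover B used (w ∷ vs) {p} p∈B v∈ vp with p ∈? used
  ... | yes p∈used = inj₁ p∈used
  ... | no  p∉used with v∈
  ...   | here refl = inj₂ (_ , here refl , x∈p∩q⁺ (x∈p∧x∉q⇒x∈p─q p∈B p∉used , Nv-intro vp))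
  ...   | there v∈′ with Bparts-cover B (used ∪ ((B ─ used) ∩ Nv G w)) vs p∈B v∈′ vp
  ...     | inj₂ (Bj , Bj∈ , p∈Bj) = inj₂ (Bj , there Bj∈ , p∈Bj)
  ...     | inj₁ p∈used′ with x∈p∪q⁻ used _ p∈used′
  ...       | inj₁ p∈used = ⊥-elim (p∉used p∈used)
  ...       | inj₂ p∈Bw   = inj₂ (_ , here refl , p∈Bw)

  Step-⊆ : ∀ {S S′} → Step G S S′ → S ⊆ S′
  Step-⊆ (_ , _ , _ , Xs , _ , refl) = p⊆p∪q (⋃ Xs)

  -- Every vertex of W = V ∖ N[S] with a neighbour in B = N(S) gets a
  -- neighbour in the new set: the chosen sets X^j dominate their parts.
  Step-dominates : ∀ {S S′ p x} → Step G S S′ → p ∈ N G S → x ∈ ∁ (N G S ∪ S) → Adj G x p → x ∈ N G S′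
  Step-dominates {S} {p = p} {x} (vs , _ , vs≃S , Xs , minimal , refl) p∈NS x∈W xp with N-elim p∈NS
  ... | v , v∈S , vp with Bparts-cover (N G S) Subset.⊥ vs p∈NS (Equivalence.to (vs≃S v) v∈S) vp
  ...   | inj₁ p∈⊥ = ⊥-elim (∉⊥ p∈⊥)
  ...   | inj₂ (Bj , Bj∈ , p∈Bj) with Pointwise-partner minimal Bj∈
  ...     | X , X∈ , (_ , dominates , _) with dominates x x∈W (p , p∈Bj , xp)
  ...       | y , y∈X , xy = N-intro (q⊆p∪q S (⋃ Xs) (∈-⋃ Xs y∈X X∈)) (Adj-sym xy)

  Step-N[N[]] : ∀ {S S′} → Step G S S′ → N[ N[ S ] ] ⊆ N[ S′ ]
  Step-N[N[]] {S} {S′} st {x} x∈ with x ∈? N[ S ]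
  ... | yes x∈N[S] = N[]-mono (Step-⊆ st) x∈N[S]
  ... | no  x∉N[S] with x∈p∪q⁻ N[ S ] _ x∈
  ...   | inj₁ x∈N[S] = ⊥-elim (x∉N[S] x∈N[S])
  ...   | inj₂ x∈N    with N-elim x∈N
  ...     | p , p∈N[S] , px with x∈p∪q⁻ S (N G S) p∈N[S]
  ...       | inj₁ p∈S  = ⊥-elim (x∉N[S] (N[]-adj p∈S px))
  ...       | inj₂ p∈NS = q⊆p∪q S′ (N G S′) (Step-dominates st p∈NS x∈W (Adj-sym px))
    where
      x∈W : x ∈ ∁ (N G S ∪ S)
      x∈W = x∉p⇒x∈∁p λ x∈′ → x∉N[S] ([ q⊆p∪q S _ , p⊆p∪q _ ]′ (x∈p∪q⁻ (N G S) S x∈′))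

  Ball⊆N[S] : ∀ a (S : ℕ → Subset n) → S 1 ≡ ⁅ a ⁆ → ∀ k → Steps G S k →
              Distance.Ball G a k ⊆ N[ S (suc k) ]
  Ball⊆N[S] a S S₁≡a zero    _     = p⊆p∪q (N G (S 1)) ∘ subst (_ ∈_) (≡-sym S₁≡a)
  Ball⊆N[S] a S S₁≡a (suc k) steps =
    Step-N[N[]] (Steps-last k steps) ∘ N[]-mono (Ball⊆N[S] a S S₁≡a k (Steps-init k steps))

  S-dominates : ∀ a (S : ℕ → Subset n) → S 1 ≡ ⁅ a ⁆ → ∀ k → Steps G S k → Connected G → ¬ InducedIn (P (suc (suc k))) G → Empty (∁ N[ S (suc k) ])
  S-dominates a S S₁≡a k steps connected no-path (x , x∉N[S]) =
    x∈p⇒x∉∁p (Ball⊆N[S] a S S₁≡a k steps (Distance.Ball-everything G a k connected no-path x)) x∉N[S]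

data SDKEdge (s : ℕ) : ℕ → ℕ → Set where
  spoke : ∀ {m} → 1 ≤ m → m ≤ s → SDKEdge s 0 m
  tail  : ∀ {m} → 1 ≤ m → m ≤ s → SDKEdge s m (m + s)

-- the spoke disjunct of sdkAdjHalf, named so that T-∨ can split it off
spokeᵇ : ℕ → ℕ → ℕ → Bool
spokeᵇ s u w = (u ≡ᵇ 0) ∧ (1 ≤ᵇ w) ∧ (w ≤ᵇ s)

sdkAdjHalf⇒ : ∀ s u w → sdkAdjHalf s u w ≡ true → SDKEdge s u w
sdkAdjHalf⇒ s u w uw with Equivalence.to (T-∨ {spokeᵇ s u w}) (Equivalence.from T-≡ uw)
... | inj₁ T-spoke with Equivalence.to (T-∧ {u ≡ᵇ 0}) T-spoke
...   | u≡0 , T-bounds with Equivalence.to (T-∧ {1 ≤ᵇ w}) T-bounds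
...     | 1≤w , w≤s with ≡ᵇ⇒≡ u 0 u≡0
...       | refl = spoke (≤ᵇ⇒≤ 1 w 1≤w) (≤ᵇ⇒≤ w s w≤s)
sdkAdjHalf⇒ s u w uw | inj₂ T-tail with Equivalence.to (T-∧ {1 ≤ᵇ u}) T-tail
...   | 1≤u , T-rest with Equivalence.to (T-∧ {u ≤ᵇ s}) T-rest
...     | u≤s , w≡u+s with ≡ᵇ⇒≡ w (u + s) w≡u+s
...       | refl = tail (≤ᵇ⇒≤ 1 u 1≤u) (≤ᵇ⇒≤ u s u≤s)

sdkAdjHalf⇐ : ∀ s u w → SDKEdge s u w → sdkAdjHalf s u w ≡ true
sdkAdjHalf⇐ s .0 w (spoke 1≤w w≤s) = Equivalence.to T-≡ (Equivalence.from (T-∨ {spokeᵇ s 0 w})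
  (inj₁ (Equivalence.from (T-∧ {1 ≤ᵇ w}) (≤⇒≤ᵇ 1≤w , ≤⇒≤ᵇ w≤s))))
sdkAdjHalf⇐ s u .(u + s) (tail 1≤u u≤s) = Equivalence.to T-≡ (Equivalence.from (T-∨ {spokeᵇ s u (u + s)})
  (inj₂ (Equivalence.from (T-∧ {1 ≤ᵇ u}) (≤⇒≤ᵇ 1≤u ,
    Equivalence.from (T-∧ {u ≤ᵇ s}) (≤⇒≤ᵇ u≤s , ≡⇒≡ᵇ (u + s) (u + s) refl)))))

sdkAdj⇒ : ∀ s u w → sdkAdjℕ s u w ≡ true → SDKEdge s u w ⊎ SDKEdge s w u
sdkAdj⇒ s u w uw with Equivalence.to (T-∨ {sdkAdjHalf s u w}) (Equivalence.from T-≡ uw)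
... | inj₁ T-uw = inj₁ (sdkAdjHalf⇒ s u w (Equivalence.to T-≡ T-uw))
... | inj₂ T-wu = inj₂ (sdkAdjHalf⇒ s w u (Equivalence.to T-≡ T-wu))

sdkAdj⇐ : ∀ s u w → SDKEdge s u w ⊎ SDKEdge s w u → sdkAdjℕ s u w ≡ true
sdkAdj⇐ s u w e = Equivalence.to T-≡ (Equivalence.from (T-∨ {sdkAdjHalf s u w})
  (Sum.map (Equivalence.from T-≡ ∘ sdkAdjHalf⇐ s u w) (Equivalence.from T-≡ ∘ sdkAdjHalf⇐ s w u) e))

sdkAdj-non : ∀ s u w → ¬ SDKEdge s u w → ¬ SDKEdge s w u → sdkAdjℕ s u w ≡ false
sdkAdj-non s u w ¬uw ¬wu = ¬-not λ uw → [ ¬uw , ¬wu ]′ (sdkAdj⇒ s u w uw)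

sdkAdj-sym : ∀ s u w → sdkAdjℕ s u w ≡ sdkAdjℕ s w u
sdkAdj-sym s u w = Bool-ext (sdkAdj⇐ s w u ∘ Sum.swap ∘ sdkAdj⇒ s u w)
                            (sdkAdj⇐ s u w ∘ Sum.swap ∘ sdkAdj⇒ s w u)

¬edge-into-centre : ∀ {s u} → ¬ SDKEdge s u 0
¬edge-into-centre e = into e refl
  where into : ∀ {s u w} → SDKEdge s u w → w ≢ 0
        into (spoke () _) refl
        into (tail (s≤s _) _) ()

¬edge-from-leaf : ∀ {s u w} → s < u → ¬ SDKEdge s u w
¬edge-from-leaf () (spoke _ _)
¬edge-from-leaf s<u (tail _ u≤s) = <-irrefl refl (≤-trans s<u u≤s)

¬edge-centre-leaf : ∀ {s b} → ¬ SDKEdge s 0 (suc (s + b))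
¬edge-centre-leaf {s} {b} e = centre-leaf e refl refl
  where centre-leaf : ∀ {u w} → SDKEdge s u w → u ≡ 0 → w ≢ suc (s + b)
        centre-leaf (spoke _ w≤s)     _  refl = <-irrefl refl (≤-trans (s≤s (m≤m+n s b)) w≤s)
        centre-leaf (tail (s≤s _) _) ()

¬edge-sub-short : ∀ {s u w} → 1 ≤ u → w ≤ s → ¬ SDKEdge s u w
¬edge-sub-short () _ (spoke _ _)
¬edge-sub-short {s} _ m+s≤s (tail {suc m} _ _) = <-irrefl refl (≤-trans (s≤s (m≤n+m s m)) m+s≤s)

¬edge-sub-leaf : ∀ {s i b} → i ≢ b → ¬ SDKEdge s (suc i) (suc (s + b))
¬edge-sub-leaf {s} {i} {b} i≢b e = sub-leaf e refl refl
  where sub-leaf : ∀ {u w} → SDKEdge s u w → u ≡ suc i → w ≢ suc (s + b)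
        sub-leaf (spoke _ _) ()
        sub-leaf (tail _ _) refl i+s≡s+b =
          i≢b (+-cancelʳ-≡ s i b (trans (suc-injective i+s≡s+b) (+-comm s b)))

sub-leaf-edge : ∀ {s i} → i < s → SDKEdge s (suc i) (suc (s + i))
sub-leaf-edge {s} {i} i<s = subst (SDKEdge s (suc i)) (cong suc (+-comm i s)) (tail (s≤s z≤n) i<s)

-- An induced SDK_s from its centre v, subdivision vertices xs and leaves ws:
-- it suffices to know the adjacencies and that the centre is not a leaf;
-- the remaining distinctness conditions follow from the adjacencies.
module SubdividedStar {n} (G : Graph n) (s : ℕ) (v : Fin n) (xs ws : Fin s → Fin n)
  (v-x    : ∀ a → Adj G v (xs a))
  (v-w    : ∀ b → adj G v (ws b) ≡ false)
  (x-x    : ∀ a a′ → a ≢ a′ → adj G (xs a) (xs a′) ≡ false)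
  (w-w    : ∀ b b′ → b ≢ b′ → adj G (ws b) (ws b′) ≡ false)
  (x-w    : ∀ a → Adj G (xs a) (ws a))
  (x-w≢   : ∀ a b → a ≢ b → adj G (xs a) (ws b) ≡ false)
  (v≢w    : ∀ b → v ≢ ws b) where

  open GraphBasics G

  -- w_a is adjacent to x_a and to no other middle vertex, so the xs are distinct
  xs-injective : ∀ {a a′} → xs a ≡ xs a′ → a ≡ a′
  xs-injective {a} {a′} e with a ≟ᶠ a′
  ... | yes a≡a′ = a≡a′
  ... | no  a≢a′ = ⊥-elim (true≢false (x-w a) (x-w≢ a′ a (a≢a′ ∘ ≡-sym)) (cong (λ z → adj G z (ws a)) e))

  -- x_b is adjacent to w_b and to no other leaf, so the ws are distinct
  ws-injective : ∀ {b b′} → ws b ≡ ws b′ → b ≡ b′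
  ws-injective {b} {b′} e with b ≟ᶠ b′
  ... | yes b≡b′ = b≡b′
  ... | no  b≢b′ = ⊥-elim (true≢false (x-w b) (x-w≢ b b′ b≢b′) (cong (adj G (xs b)) e))

  v≢x : ∀ a → v ≢ xs a
  v≢x a = Adj-irrefl (v-x a)

  -- middle vertices are adjacent to v, leaves are not
  x≢w : ∀ a b → xs a ≢ ws b
  x≢w a b e = true≢false (v-x a) (v-w b) (cong (adj G v) e)

  data Role : Fin n → ℕ → Set where
    centre : Role v 0
    sub    : ∀ a → Role (xs a) (suc (toℕ a))
    leaf   : ∀ b → Role (ws b) (suc (s + toℕ b))

  Role-adj : ∀ {y z u w} → Role y u → Role z w → adj G y z ≡ sdkAdjℕ s u w
  Role-adj centre   centre    = trans (irrfl G v) (≡-sym (sdkAdj-non s 0 0 ¬edge-into-centre ¬edge-into-centre))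
  Role-adj centre   (sub a)   = trans (v-x a) (≡-sym (sdkAdj⇐ s 0 _ (inj₁ (spoke (s≤s z≤n) (toℕ<n a)))))
  Role-adj centre   (leaf b)  = trans (v-w b) (≡-sym (sdkAdj-non s 0 _ ¬edge-centre-leaf
                                  (¬edge-from-leaf (s≤s (m≤m+n s (toℕ b))))))
  Role-adj (sub a)  (sub a′) with a ≟ᶠ a′
  ... | yes refl = trans (irrfl G (xs a)) (≡-sym (sdkAdj-non s _ _ (¬edge-sub-short (s≤s z≤n) (toℕ<n a))
                                                              (¬edge-sub-short (s≤s z≤n) (toℕ<n a))))
  ... | no  a≢a′ = trans (x-x a a′ a≢a′) (≡-sym (sdkAdj-non s _ _ (¬edge-sub-short (s≤s z≤n) (toℕ<n a′))
                                                                  (¬edge-sub-short (s≤s z≤n) (toℕ<n a))))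
  Role-adj (sub a)  (leaf b) with a ≟ᶠ b
  ... | yes refl = trans (x-w a) (≡-sym (sdkAdj⇐ s _ _ (inj₁ (sub-leaf-edge (toℕ<n a)))))
  ... | no  a≢b  = trans (x-w≢ a b a≢b) (≡-sym (sdkAdj-non s _ _ (¬edge-sub-leaf (a≢b ∘ toℕ-injective))
                                           (¬edge-from-leaf (s≤s (m≤m+n s (toℕ b))))))
  Role-adj (leaf b) (leaf b′) = trans (leaves b b′) (≡-sym (sdkAdj-non s _ _
                                  (¬edge-from-leaf (s≤s (m≤m+n s (toℕ b))))
                                  (¬edge-from-leaf (s≤s (m≤m+n s (toℕ b′))))))
    where leaves : ∀ b b′ → adj G (ws b) (ws b′) ≡ false
          leaves b b′ with b ≟ᶠ b′
          ... | yes refl = irrfl G (ws b)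
          ... | no  b≢b′ = w-w b b′ b≢b′
  -- the remaining cases follow by symmetry of both adjacency relations
  Role-adj {y} {z} {u} {w} ρ@(sub _)  σ@centre  = trans (Graph.sym G y z) (trans (Role-adj σ ρ) (sdkAdj-sym s w u))
  Role-adj {y} {z} {u} {w} ρ@(leaf _) σ@centre  = trans (Graph.sym G y z) (trans (Role-adj σ ρ) (sdkAdj-sym s w u))
  Role-adj {y} {z} {u} {w} ρ@(leaf _) σ@(sub _) = trans (Graph.sym G y z) (trans (Role-adj σ ρ) (sdkAdj-sym s w u))

  Role-injective : ∀ {y z u w} → Role y u → Role z w → y ≡ z → u ≡ w
  Role-injective centre   centre    _ = refl
  Role-injective centre   (sub a)   e = ⊥-elim (v≢x a e)
  Role-injective centre   (leaf b)  e = ⊥-elim (v≢w b e)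
  Role-injective (sub a)  centre    e = ⊥-elim (v≢x a (≡-sym e))
  Role-injective (sub a)  (sub a′)  e = cong (suc ∘ toℕ) (xs-injective e)
  Role-injective (sub a)  (leaf b)  e = ⊥-elim (x≢w a b e)
  Role-injective (leaf b) centre    e = ⊥-elim (v≢w b (≡-sym e))
  Role-injective (leaf b) (sub a)   e = ⊥-elim (x≢w a b (≡-sym e))
  Role-injective (leaf b) (leaf b′) e = cong (λ z → suc (s + toℕ z)) (ws-injective e)

  embedding : Fin (suc (s + s)) → Fin n
  embedding zero    = v
  embedding (suc k) = [ xs , ws ]′ (splitAt s k)

  role : ∀ i → Role (embedding i) (toℕ i)
  role zero = centre
  role (suc k) with splitAt s k | join-splitAt s s k
  ... | inj₁ a | refl = subst (λ z → Role (xs a) (suc z)) (≡-sym (toℕ-↑ˡ a s)) (sub a)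
  ... | inj₂ b | refl = subst (λ z → Role (ws b) (suc z)) (≡-sym (toℕ-↑ʳ s b)) (leaf b)

  induced : InducedIn (SDK s) G
  induced = embedding
          , (λ {i} {j} e → toℕ-injective (Role-injective (role i) (role j) e))
          , λ i j → Role-adj (role i) (role j)

starBound : ℕ → ℕ
starBound s = ramseyBound 3 (ramseyBound 4 s)

module _ {n} (G : Graph n) where
  open GraphBasics G

  -- In an inclusion-minimal dominating set X, every x ∈ X has a private
  -- neighbour: some w ∈ W adjacent to x and to no other member of X
  -- (otherwise X - x would still dominate).
  private-neighbour : ∀ {W Bj X x} → MinDom G W Bj X → x ∈ X →
    ∃[ w ] (w ∈ W × Adj G w x × (∀ x′ → x′ ∈ X → x′ ≢ x → adj G w x′ ≡ false))
  private-neighbour {W} {Bj} {X} {x} (_ , dominates , minimal) x∈X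
    with any? (λ w → (w ∈? W) ×-dec (any? λ b → (b ∈? Bj) ×-dec Adj? w b)
                       ×-dec ¬? (any? λ y → (y ∈? (X - x)) ×-dec Adj? w y))
  ... | yes (w , w∈W , needs , ¬other) with dominates w w∈W needs
  ...   | y , y∈X , wy with y ≟ᶠ x
  ...     | yes refl = w , w∈W , wy , λ x′ x′∈X x′≢x → Nonadj λ wx′ → ¬other (x′ , x∈p∧x≢y⇒x∈p-y x′∈X x′≢x , wx′)
  ...     | no  y≢x  = ⊥-elim (¬other (y , x∈p∧x≢y⇒x∈p-y y∈X y≢x , wy))
  private-neighbour {W} {Bj} {X} {x} (_ , dominates , minimal) x∈X
      | no ¬unprivate = ⊥-elim (<⇒≱ (x∈p⇒∣p-x∣<∣p∣ x∈X) (p⊆q⇒∣p∣≤∣q∣ (minimal (X - x) (p─q⊆p X ⁅ x ⁆) smaller)))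
    where
      smaller : Dominates G W Bj (X - x)
      smaller w w∈W needs with any? (λ y → (y ∈? (X - x)) ×-dec Adj? w y)
      ... | yes found = found
      ... | no  none  = ⊥-elim (¬unprivate (w , w∈W , needs , none))

  clique-injective : ∀ {k} (f : Fin k → Fin n) → (∀ i j → i ≢ j → Adj G (f i) (f j)) → ∀ {i j} → f i ≡ f j → i ≡ j
  clique-injective f f-adj {i} {j} fi≡fj with i ≟ᶠ j
  ... | yes i≡j = i≡j
  ... | no  i≢j = ⊥-elim (Adj-irrefl (f-adj i j i≢j) fi≡fj)

  clique-K4 : (f : Fin 4 → Fin n) → (∀ i j → i ≢ j → Adj G (f i) (f j)) → HasK4 G
  clique-K4 f f-adj = f , clique-injective f f-adj , f-adj

  cone-K4 : ∀ v (h : Fin 3 → Fin n) → (∀ i → Adj G v (h i)) → (∀ i j → i ≢ j → Adj G (h i) (h j)) → HasK4 G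
  cone-K4 v h v-h h-adj = clique-K4 f f-adj
    where
      f : Fin 4 → Fin n
      f zero    = v
      f (suc i) = h i
      f-adj : ∀ i j → i ≢ j → Adj G (f i) (f j)
      f-adj zero    zero    i≢j = ⊥-elim (i≢j refl)
      f-adj zero    (suc j) _   = v-h j
      f-adj (suc i) zero    _   = Adj-sym (v-h i)
      f-adj (suc i) (suc j) i≢j = h-adj i j (i≢j ∘ cong suc)

  record PrivateNeighbour (v : Fin n) (X : Subset n) (x : Fin n) : Set where
    field
      vertex     : Fin n
      adjacent   : Adj G x vertex
      exclusive  : ∀ x′ → x′ ∈ X → x′ ≢ x → adj G x′ vertex ≡ false
      v-nonadj   : adj G v vertex ≡ false
      v-distinct : v ≢ vertex

  module PrivateStar (s : ℕ) (no-sdk : ¬ InducedIn (SDK s) G) (no-k4 : ¬ HasK4 G)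
                     (v : Fin n) (X : Subset n) (X⊆Nv : X ⊆ Nv G v)
                     (pn : ∀ x → x ∈ X → PrivateNeighbour v X x) where

    v-adj : ∀ {x} → x ∈ X → Adj G v x
    v-adj = Nv-elim ∘ X⊆Nv

    -- R(4, s) independent members h of X are impossible: Ramsey among their
    -- private neighbours w gives a K₄ or an independent s-set, and the latter
    -- spans an induced SDK_s with centre v, middle vertices h and leaves w.
    module Independent (h : Fin (ramseyBound 4 s) → Fin n) (h-inj : ∀ {i j} → h i ≡ h j → i ≡ j)
                       (h∈X : ∀ i → h i ∈ X) (h-indep : ∀ i j → i ≢ j → adj G (h i) (h j) ≡ false) where

      private-of : ∀ i → PrivateNeighbour v X (h i)
      private-of i = pn (h i) (h∈X i)

      w : Fin (ramseyBound 4 s) → Fin n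
      w = PrivateNeighbour.vertex ∘ private-of

      impossible : ⊥
      impossible with Ramsey.ramsey (λ i j → adj G (w i) (w j)) (λ i j → Graph.sym G (w i) (w j)) 4 s
                        (allFin _) (Unique.allFin⁺ _) (≤-reflexive (≡-sym (length-tabulate (λ i → i))))
      ... | inj₁ (g , _ , _ , g-adj)       = no-k4 (clique-K4 (w ∘ g) g-adj)
      ... | inj₂ (g , g-inj , _ , g-indep) = no-sdk (SubdividedStar.induced G s v (h ∘ g) (w ∘ g)
              (λ a → v-adj (h∈X (g a)))
              (λ b → PrivateNeighbour.v-nonadj (private-of (g b)))
              (λ a a′ a≢a′ → h-indep (g a) (g a′) (a≢a′ ∘ g-inj))
              g-indep
              (λ a → PrivateNeighbour.adjacent (private-of (g a)))
              (λ a b a≢b → PrivateNeighbour.exclusive (private-of (g b)) (h (g a)) (h∈X (g a)) (a≢b ∘ g-inj ∘ h-inj))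
              (λ b → PrivateNeighbour.v-distinct (private-of (g b))))

    -- Ramsey inside X gives a triangle (a K₄ together with v) or R(4, s)
    -- independent vertices.
    bound : ∣ X ∣ < starBound s
    bound with starBound s ≤? ∣ X ∣
    ... | no  small = ≰⇒> small
    ... | yes large with Ramsey.ramsey (adj G) (Graph.sym G) 3 (ramseyBound 4 s) (elements X) (elements-unique X)
                           (subst (_ ≤_) (≡-sym (length-elements X)) large)
    ...   | inj₁ (t , _ , t∈ , t-adj) = ⊥-elim (no-k4 (cone-K4 v t (λ i → v-adj (∈-elements X (t∈ i))) t-adj))
    ...   | inj₂ (h , h-inj , h∈ , h-indep) = ⊥-elim (Independent.impossible h h-inj (∈-elements X ∘ h∈) h-indep)

Pointwise-All : ∀ {A B : Set} {R : A → B → Set} {P : B → Set} {as bs} →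
                (∀ {a b} → a ∈ₗ as → R a b → P b) → Pointwise R as bs → All P bs
Pointwise-All f []       = []
Pointwise-All f (r ∷ rs) = f (here refl) r ∷ Pointwise-All (f ∘ there) rs

module _ {n} (G : Graph n) where
  open GraphBasics G

  Bparts-length : ∀ B used vs → length (Bparts G B used vs) ≡ length vs
  Bparts-length B used []       = refl
  Bparts-length B used (v ∷ vs) = cong suc (Bparts-length B _ vs)

  Bparts-⊆Nv : ∀ B used vs {Bj} → Bj ∈ₗ Bparts G B used vs → ∃[ v ] (v ∈ₗ vs × Bj ⊆ Nv G v)
  Bparts-⊆Nv B used (v ∷ vs) (here refl) = v , here refl , proj₂ ∘ x∈p∩q⁻ (B ─ used) (Nv G v)
  Bparts-⊆Nv B used (v ∷ vs) (there Bj∈) with Bparts-⊆Nv B _ vs Bj∈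
  ... | w , w∈ , Bj⊆ = w , there w∈ , Bj⊆

module _ {n} (G : Graph n) (s : ℕ) (no-sdk : ¬ InducedIn (SDK s) G) (no-k4 : ¬ HasK4 G) where
  open GraphBasics G

  private
    R : ℕ
    R = starBound s

  -- A minimal dominating part X^j ⊆ B^j ⊆ N(v_j) is small: its members have
  -- private neighbours in W = V ∖ N[S], which lies outside N[v_j].
  part-bound : ∀ {S v Bj X} → v ∈ S → Bj ⊆ Nv G v → MinDom G (∁ (N G S ∪ S)) Bj X → ∣ X ∣ < R
  part-bound {S} {v} {Bj} {X} v∈S Bj⊆Nv minimal@(X⊆Bj , _) =
    PrivateStar.bound G s no-sdk no-k4 v X (Bj⊆Nv ∘ X⊆Bj) private-outside
    where
      private-outside : ∀ x → x ∈ X → PrivateNeighbour G v X x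
      private-outside x x∈X with private-neighbour G minimal x∈X
      ... | w , w∈W , wx , exclusive = record
        { vertex     = w
        ; adjacent   = Adj-sym wx
        ; exclusive  = λ x′ x′∈X x′≢x → trans (Graph.sym G x′ w) (exclusive x′ x′∈X x′≢x)
        ; v-nonadj   = Nonadj λ vw → x∈p⇒x∉∁p (p⊆p∪q S (N-intro v∈S vw)) w∈W
        ; v-distinct = λ { refl → x∈p⇒x∉∁p (q⊆p∪q (N G S) S v∈S) w∈W }
        }

  -- One step multiplies the size by at most R + 1, since S′ = S ∪ ⋃_j X^j
  -- has one part X^j per vertex v_j of S.
  Step-size : ∀ {S S′} → Step G S S′ → ∣ S′ ∣ ≤ ∣ S ∣ * suc R
  Step-size {S} (vs , vs-unique , vs≃S , Xs , minimal , refl) = begin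
    ∣ S ∪ ⋃ Xs ∣           ≤⟨ ∣p∪q∣≤∣p∣+∣q∣ S (⋃ Xs) ⟩
    ∣ S ∣ + ∣ ⋃ Xs ∣       ≤⟨ +-monoʳ-≤ ∣ S ∣ (∣⋃∣≤ R Xs (Pointwise-All part-small minimal)) ⟩
    ∣ S ∣ + length Xs * R  ≡⟨ cong (λ m → ∣ S ∣ + m * R) #parts ⟩
    ∣ S ∣ + length vs * R  ≤⟨ +-monoʳ-≤ ∣ S ∣ (*-monoˡ-≤ R #vs) ⟩
    ∣ S ∣ + ∣ S ∣ * R      ≡⟨ ≡-sym (*-suc ∣ S ∣ R) ⟩
    ∣ S ∣ * suc R          ∎
    where
      open ≤-Reasoning
      part-small : ∀ {Bj X} → Bj ∈ₗ Bparts G (N G S) Subset.⊥ vs → MinDom G (∁ (N G S ∪ S)) Bj X → ∣ X ∣ ≤ R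
      part-small Bj∈ X-minimal with Bparts-⊆Nv G (N G S) Subset.⊥ vs Bj∈
      ... | v , v∈vs , Bj⊆Nv = <⇒≤ (part-bound (Equivalence.from (vs≃S v) v∈vs) Bj⊆Nv X-minimal)
      #parts : length Xs ≡ length vs
      #parts = trans (≡-sym (Pointwise-length minimal)) (Bparts-length G (N G S) Subset.⊥ vs)
      #vs : length vs ≤ ∣ S ∣
      #vs = length-unique≤ S vs vs-unique (λ {x} → Equivalence.from (vs≃S x))

  S-size : ∀ a (S : ℕ → Subset n) → S 1 ≡ ⁅ a ⁆ → ∀ j → Steps G S j → ∣ S (suc j) ∣ ≤ suc R ^ j
  S-size a S S₁≡a zero    _     = ≤-reflexive (trans (cong ∣_∣ S₁≡a) (∣⁅x⁆∣≡1 a))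
  S-size a S S₁≡a (suc j) steps = begin
    ∣ S (suc (suc j)) ∣  ≤⟨ Step-size (Steps-last j steps) ⟩
    ∣ S (suc j) ∣ * suc R ≤⟨ *-monoˡ-≤ (suc R) (S-size a S S₁≡a j (Steps-init j steps)) ⟩
    suc R ^ j * suc R    ≡⟨ *-comm (suc R ^ j) (suc R) ⟩
    suc R ^ suc j        ∎
    where open ≤-Reasoning

P₁-induced : ∀ {n} (G : Graph n) → Fin n → InducedIn (P 1) G
P₁-induced G a = (λ _ → a) , (λ { {zero} {zero} _ → refl }) , λ { zero zero → irrfl G a }

-- For t = 1 the hypotheses are contradictory, since P_1 is a single vertex.
-- For t = k + 2 we have S_{t-1} = S_{k+1}, of size at most (R + 1)^k by
-- part (1), and dominating by part (2).
lemma3p3 : (s t : ℕ) → 1 ≤ s → 1 ≤ t →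
    Σ ℕ λ M →
      ∀ (n : ℕ) (G : Graph n) → Connected G →
      ¬ InducedIn (P t) G → ¬ InducedIn (SDK s) G → ¬ HasK4 G →
      ∀ (a : Fin n) (S : ℕ → Subset n) → S 1 ≡ ⁅ a ⁆ →
      (∀ i → 1 ≤ i → i ≤ t ∸ 2 → Step G (S i) (S (suc i))) →
      (∣ S (t ∸ 1) ∣ ≤ M) × Empty (∁ (S (t ∸ 1) ∪ N G (S (t ∸ 1))))
lemma3p3 s (suc zero) _ _ = 0 , λ n G _ no-P₁ _ _ a _ _ _ → ⊥-elim (no-P₁ (P₁-induced G a))
lemma3p3 s (suc (suc k)) _ _ = suc (starBound s) ^ k ,
  λ n G connected no-path no-sdk no-k4 a S S₁≡a steps →
    S-size G s no-sdk no-k4 a S S₁≡a k steps , S-dominates G a S S₁≡a k steps connected no-path
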